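{- Let $S$ be a confluent fragment of $\lambda_{alg}^{\to}$, viewed as a fragment of $\lambda_{alg}^{=}$. For every term $M\in S$ and every value $V$: if $M\to^{=*}_{a\cup\beta}V$ (algebraic equality restricted to $S$), then there is a value $V'$ with $M\to^{*}_{a\cup\beta}V'$ and $V(\to^{=}_a)^{*}V'$ (algebraic equality restricted to $S$).
   Context: Fix a ring of scalars (elements $\alpha,\beta$). Terms, values and base terms are given by: $M,N,L ::= V \mid (M)~N \mid \alpha.M \mid M+N$ (terms); $U,V,W ::= 0 \mid B \mid \alpha.V \mid V+W$ (values); $B ::= x \mid \lambda x\,M$ (base terms). $M[x:=N]$ is capture-avoiding substitution. Rewrite rules: $(\beta_n)$ $(\lambda x\,M)~N\to M[x:=N]$. $(A)$ $(M+N)~L\to (M)~L+(N)~L$; $(\alpha.M)~N\to\alpha.(M)~N$; $(0)~M\to 0$. (Asso) $M+(N+L)\to(M+N)+L$ and $(M+N)+L\to M+(N+L)$. (Com) $M+N\to N+M$. $(F)$ $\alpha.M+\beta.M\to(\alpha+\beta).M$; $\alpha.M+M\to(\alpha+1).M$; $M+M\to(1+1).M$; $\alpha.(\beta.M)\to(\alpha\beta).M$. $(S)$ $\alpha.(M+N)\to\alpha.M+\alpha.N$; $1.M\to M$; $0.M\to 0$; $\alpha.0\to 0$; $0+M\to M$. Context rules $(\xi)$: from $M\to M'$ infer $(M)~N\to(M')~N$, $M+N\to M'+N$, $N+M\to N+M'$, $\alpha.M\to\alpha.M'$. Let $L=\mathrm{Asso}\cup\mathrm{Com}\cup F\cup S$.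 $\to_a$ is generated by $A\cup L$ closed under $\xi$; $\to_{\beta_n}$ is generated by $\beta_n$ closed under $\xi$; $\to_{a\cup\beta}:=\to_a\cup\to_{\beta_n}$ (language $\lambda_{alg}^{\to}$). $R^{*}$ is reflexive-transitive closure. A fragment of $\lambda_{alg}^{\to}$ is a set $S$ of terms closed under $\to_{a\cup\beta}$, with the relation restricted to $S$; it is confluent if $\to_{a\cup\beta}$ restricted to $S$ is confluent. As a fragment of $\lambda_{alg}^{=}$, $S$ carries the restricted algebraic equality: $M\to^{=}_a N$ iff $M,N\in S$ and ($M\to_a N$ or $N\to_a M$); and $\to^{=}_{a\cup\beta}$ is this relation union $\to_{\beta_n}$. -}

module Defs where

open import Level using (Level; _⊔_)
open import Algebra.Bundles using (Ring)
open import Data.Nat using (ℕ; zero; suc)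
open import Data.Product using (Σ; _×_; _,_; ∃)
open import Data.Sum using (_⊎_)
open import Relation.Binary.Construct.Closure.ReflexiveTransitive using (Star)

module Lambda {c ℓ : Level} (R : Ring c ℓ) where

  open Ring R using (Carrier; _+_; _*_; 0#; 1#)

  Scalar : Set c
  Scalar = Carrier

  -- Terms of λ_alg, variables as de Bruijn indices (terms up to α-equivalence).
  infixl 6 _⊕_
  infixr 7 _·_
  data Term : Set c where
    𝟎   : Term
    var : ℕ → Term
    lam : Term → Term
    app : Term → Term → Term
    _·_ : Scalar → Term → Term
    _⊕_ : Term → Term → Term

  data Base : Term → Set c where
    var : ∀ n → Base (var n)
    lam : ∀ M → Base (lam M)

  data Value : Term → Set c where
    𝟎   : Value 𝟎
    base : ∀ {B} → Base B → Value B
    _·_ : ∀ α {V} → Value V → Value (α · V)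
    _⊕_ : ∀ {V W} → Value V → Value W → Value (V ⊕ W)

  ext : (ℕ → ℕ) → ℕ → ℕ
  ext ρ zero = zero
  ext ρ (suc n) = suc (ρ n)

  rename : (ℕ → ℕ) → Term → Term
  rename ρ 𝟎 = 𝟎
  rename ρ (var n) = var (ρ n)
  rename ρ (lam M) = lam (rename (ext ρ) M)
  rename ρ (app M N) = app (rename ρ M) (rename ρ N)
  rename ρ (α · M) = α · rename ρ M
  rename ρ (M ⊕ N) = rename ρ M ⊕ rename ρ N

  exts : (ℕ → Term) → ℕ → Term
  exts σ zero = var zero
  exts σ (suc n) = rename suc (σ n)

  subst : (ℕ → Term) → Term → Term
  subst σ 𝟎 = 𝟎
  subst σ (var n) = σ n
  subst σ (lam M) = lam (subst (exts σ) M)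
  subst σ (app M N) = app (subst σ M) (subst σ N)
  subst σ (α · M) = α · subst σ M
  subst σ (M ⊕ N) = subst σ M ⊕ subst σ N

  single : Term → ℕ → Term
  single N zero = N
  single N (suc n) = var n

  -- M[x:=N] where x is the variable bound by the enclosing λ
  _[_] : Term → Term → Term
  M [ N ] = subst (single N) M

  data βn : Term → Term → Set c where
    beta : ∀ M N → βn (app (lam M) N) (M [ N ])

  data A : Term → Term → Set c where
    A-plus : ∀ M N L → A (app (M ⊕ N) L) (app M L ⊕ app N L)
    A-scal : ∀ α M N → A (app (α · M) N) (α · app M N)
    A-zero : ∀ M → A (app 𝟎 M) 𝟎

  data L : Term → Term → Set c where
    asso₁ : ∀ M N P → L (M ⊕ (N ⊕ P)) ((M ⊕ N) ⊕ P)
    asso₂ : ∀ M N P → L ((M ⊕ N) ⊕ P) (M ⊕ (N ⊕ P))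
    com   : ∀ M N → L (M ⊕ N) (N ⊕ M)
    F₁    : ∀ α β M → L (α · M ⊕ β · M) ((α + β) · M)
    F₂    : ∀ α M → L (α · M ⊕ M) ((α + 1#) · M)
    F₃    : ∀ M → L (M ⊕ M) ((1# + 1#) · M)
    F₄    : ∀ α β M → L (α · (β · M)) ((α * β) · M)
    S₁    : ∀ α M N → L (α · (M ⊕ N)) (α · M ⊕ α · N)
    S₂    : ∀ M → L (1# · M) M
    S₃    : ∀ M → L (0# · M) 𝟎
    S₄    : ∀ α → L (α · 𝟎) 𝟎
    S₅    : ∀ M → L (𝟎 ⊕ M) M

  data Ctx (H : Term → Term → Set c) : Term → Term → Set c where
    head  : ∀ {M M'} → H M M' → Ctx H M M'
    appL  : ∀ {M M'} N → Ctx H M M' → Ctx H (app M N) (app M' N)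
    plusL : ∀ {M M'} N → Ctx H M M' → Ctx H (M ⊕ N) (M' ⊕ N)
    plusR : ∀ {M M'} N → Ctx H M M' → Ctx H (N ⊕ M) (N ⊕ M')
    scal  : ∀ {M M'} α → Ctx H M M' → Ctx H (α · M) (α · M')

  data AL : Term → Term → Set c where
    inA : ∀ {M N} → A M N → AL M N
    inL : ∀ {M N} → L M N → AL M N

  _→a_ : Term → Term → Set c
  _→a_ = Ctx AL

  _→β_ : Term → Term → Set c
  _→β_ = Ctx βn

  _→aβ_ : Term → Term → Set c
  M →aβ N = (M →a N) ⊎ (M →β N)

  module _ {p : Level} (S : Term → Set p) where

    IsFragment : Set (c ⊔ p)
    IsFragment = ∀ {M N} → S M → M →aβ N → S N

    _→aβS_ : Term → Term → Set (c ⊔ p)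
    M →aβS N = S M × S N × (M →aβ N)

    IsConfluent : Set (c ⊔ p)
    IsConfluent = ∀ {M N₁ N₂} → Star _→aβS_ M N₁ → Star _→aβS_ M N₂ →
                  ∃ λ P → Star _→aβS_ N₁ P × Star _→aβS_ N₂ P

    _→a=_ : Term → Term → Set (c ⊔ p)
    M →a= N = S M × S N × ((M →a N) ⊎ (N →a M))

    _→aβ=_ : Term → Term → Set (c ⊔ p)
    M →aβ= N = (M →a= N) ⊎ Lift' (M →β N)
      where
      open import Level using (Lift)
      Lift' : Set c → Set (c ⊔ p)
      Lift' X = Lift p X

module Submission where

open import Defs
open import Level using (Level; lift)
open import Algebra.Bundles using (Ring)
open import Data.Product using (∃; _×_; _,_; proj₁; proj₂)
open import Data.Sum using (inj₁; inj₂)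
open import Relation.Nullary using (¬_; contradiction)
open import Relation.Binary.Construct.Closure.ReflexiveTransitive using (Star; ε; _◅_; _◅◅_)

-- Confluence turns the symmetric steps of →^=_{a∪β} into a common reduct of M and V
-- (Church–Rosser). A reduct of a value is again a value, reached by algebraic steps only,
-- because values contain no redex (β or A) and the rules L map values to values.

module _ {c ℓ : Level} (R : Ring c ℓ) where
  open Lambda R
  open Ring R using (_+_; _*_; 1#)

  ¬Value-app : ∀ {M N} → ¬ Value (app M N)
  ¬Value-app (base ())

  Value-⊕⁻ : ∀ {M N} → Value (M ⊕ N) → Value M × Value N
  Value-⊕⁻ (v ⊕ w) = v , w
  Value-⊕⁻ (base ())

  Value-·⁻ : ∀ {α M} → Value (α · M) → Value M
  Value-·⁻ (_ · v) = v
  Value-·⁻ (base ())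

  Value-L : ∀ {V W} → L V W → Value V → Value W
  Value-L (asso₁ _ _ _) u with Value-⊕⁻ u
  ... | v , vw with Value-⊕⁻ vw
  ... | w , x = (v ⊕ w) ⊕ x
  Value-L (asso₂ _ _ _) u with Value-⊕⁻ u
  ... | vw , x with Value-⊕⁻ vw
  ... | v , w = v ⊕ (w ⊕ x)
  Value-L (com _ _) u with Value-⊕⁻ u
  ... | v , w = w ⊕ v
  Value-L (F₁ α β _) u with Value-⊕⁻ u
  ... | αv , _ = (α + β) · Value-·⁻ αv
  Value-L (F₂ α _) u with Value-⊕⁻ u
  ... | _ , v = (α + 1#) · v
  Value-L (F₃ _) u with Value-⊕⁻ u
  ... | v , _ = (1# + 1#) · v
  Value-L (F₄ α β _) u = (α * β) · Value-·⁻ (Value-·⁻ u)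
  Value-L (S₁ α _ _) u with Value-⊕⁻ (Value-·⁻ u)
  ... | v , w = (α · v) ⊕ (α · w)
  Value-L (S₂ _) u = Value-·⁻ u
  Value-L (S₃ _) _ = 𝟎
  Value-L (S₄ _) _ = 𝟎
  Value-L (S₅ _) u with Value-⊕⁻ u
  ... | _ , v = v

  Value-→a : ∀ {V W} → V →a W → Value V → Value W
  Value-→a (head (inA (A-plus _ _ _))) u = contradiction u ¬Value-app
  Value-→a (head (inA (A-scal _ _ _))) u = contradiction u ¬Value-app
  Value-→a (head (inA (A-zero _)))     u = contradiction u ¬Value-app
  Value-→a (head (inL l))              u = Value-L l u
  Value-→a (appL _ _)                  u = contradiction u ¬Value-app
  Value-→a (plusL _ s) u with Value-⊕⁻ u
  ... | v , w = Value-→a s v ⊕ w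
  Value-→a (plusR _ s) u with Value-⊕⁻ u
  ... | v , w = v ⊕ Value-→a s w
  Value-→a (scal α s) u = α · Value-→a s (Value-·⁻ u)

  Value-β-normal : ∀ {V W} → Value V → ¬ (V →β W)
  Value-β-normal u (head (beta _ _)) = ¬Value-app u
  Value-β-normal u (appL _ _)        = ¬Value-app u
  Value-β-normal u (plusL _ s)       = Value-β-normal (proj₁ (Value-⊕⁻ u)) s
  Value-β-normal u (plusR _ s)       = Value-β-normal (proj₂ (Value-⊕⁻ u)) s
  Value-β-normal u (scal _ s)        = Value-β-normal (Value-·⁻ u) s

  module _ {p : Level} (S : Term → Set p) where

    reduct-of-Value : ∀ {V W} → Value V → Star (_→aβS_ S) V W →
                      Value W × Star (_→a=_ S) V W
    reduct-of-Value v ε = v , ε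
    reduct-of-Value v ((_ , _ , inj₂ b) ◅ _) = contradiction b (Value-β-normal v)
    reduct-of-Value v ((sV , sV₁ , inj₁ a) ◅ r) with reduct-of-Value (Value-→a a v) r
    ... | w , q = w , (sV , sV₁ , inj₁ a) ◅ q

    church-rosser : IsFragment S → IsConfluent S → ∀ {M N} → S M → Star (_→aβ=_ S) M N →
                    ∃ λ P → Star (_→aβS_ S) M P × Star (_→aβS_ S) N P
    church-rosser frag conf {M} sM ε = M , ε , ε
    church-rosser frag conf sM (inj₁ (_ , sM₁ , inj₁ a) ◅ r)
      with church-rosser frag conf sM₁ r
    ... | P , m₁p , np = P , (sM , sM₁ , inj₁ a) ◅ m₁p , np
    church-rosser frag conf sM (inj₁ (_ , sM₁ , inj₂ a) ◅ r)
      with church-rosser frag conf sM₁ r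
    ... | P , m₁p , np with conf m₁p ((sM₁ , sM , inj₁ a) ◅ ε)
    ... | Q , pq , mq = Q , mq , np ◅◅ pq
    church-rosser frag conf sM (inj₂ (lift b) ◅ r)
      with church-rosser frag conf (frag sM (inj₂ b)) r
    ... | P , m₁p , np = P , (sM , frag sM (inj₂ b) , inj₂ b) ◅ m₁p , np

theorem5 : ∀ {c ℓ p} (R : Ring c ℓ) → let open Lambda R in
    (S : Term → Set p) → IsFragment S → IsConfluent S →
    ∀ M V → S M → Value V → Star (_→aβ=_ S) M V →
    ∃ λ V' → Value V' × Star (_→aβS_ S) M V' × Star (_→a=_ S) V V'
theorem5 R S frag conf M V sM v M=V with church-rosser R S frag conf sM M=V
... | V' , M→V' , V→V' with reduct-of-Value R S v V→V'
... | v' , V=V' = V' , v' , M→V' , V=V'
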